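{- Let $n,m,d\in\mathbb{N}$ and let $X_0<\dots<X_{d-1}$ be finite $\omega^n$-large subsets of $\mathbb{N}$ such that $\{\max X_i:i<d\}$ is $\omega^m$-large. Then $X_0\cup\dots\cup X_{d-1}$ is $\omega^{n+m}$-large.
   Context: $X<Y$ means every element of $X$ is below every element of $Y$. Fundamental sequences: $\{0\}(x)=0$; for $\alpha\neq0$ write $\alpha=\delta+\omega^\gamma$ in Cantor normal form with $\omega^\gamma$ the last term; $\{\alpha\}(x)=\delta$ if $\gamma=0$, $\delta+\omega^{\gamma'}\cdot x$ if $\gamma=\gamma'+1$, $\delta+\omega^{\{\gamma\}(x)}$ if $\gamma$ is a limit. For finite $X=\{x_0<\dots<x_s\}$, $\{\alpha\}(X)=\{\cdots\{\{\alpha\}(x_0)\}(x_1)\cdots\}(x_s)$ and $X$ is $\alpha$-large iff $\{\alpha\}(X)=0$. -}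

module Defs where

open import Data.Nat using (ℕ; zero; suc; _<_; _⊔_)
open import Data.List using (List; []; _∷_; foldr)
open import Data.List.Relation.Unary.All using (All)

-- Ordinal notations below ε₀ in Cantor normal form, written as a snoc-list
-- of exponents:  δ ⊕ω^ γ  denotes  δ + ω^γ  (ω^γ is the LAST term).
infixl 6 _⊕ω^_
data Ord : Set where
  𝟘     : Ord
  _⊕ω^_ : Ord → Ord → Ord

nat : ℕ → Ord
nat zero    = 𝟘
nat (suc k) = nat k ⊕ω^ 𝟘

ω^ : Ord → Ord
ω^ α = 𝟘 ⊕ω^ α

addMul : Ord → Ord → ℕ → Ord
addMul δ γ zero    = δ
addMul δ γ (suc x) = addMul δ γ x ⊕ω^ γ

fs : Ord → ℕ → Ord
fs 𝟘 x = 𝟘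
fs (δ ⊕ω^ 𝟘) x = δ
fs (δ ⊕ω^ (γ' ⊕ω^ 𝟘)) x = addMul δ γ' x              -- γ = γ' + 1
fs (δ ⊕ω^ (γ₀ ⊕ω^ (a ⊕ω^ b))) x = δ ⊕ω^ fs (γ₀ ⊕ω^ (a ⊕ω^ b)) x  -- γ limit

-- {α}(X) for X = x₀ < ... < x_s given as an increasing list
fsSet : Ord → List ℕ → Ord
fsSet α []       = α
fsSet α (x ∷ xs) = fsSet (fs α x) xs

Large : Ord → List ℕ → Set
Large α X = fsSet α X ≡ 𝟘
  where open import Relation.Binary.PropositionalEquality using (_≡_)

_≪_ : List ℕ → List ℕ → Set
X ≪ Y = All (λ x → All (λ y → x < y) Y) X

maxL : List ℕ → ℕ
maxL = foldr _⊔_ 0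

-- Write α ⊕ β for the concatenation of Cantor normal forms. A set is (α ⊕ β)-large
-- iff it splits into a β-large initial segment and an α-large rest, the converse
-- needing that α-largeness survives adding smaller elements in front; below ω^ω this
-- holds because {ω^(j+1)}(z) = ω^j·z only grows with z. Now induct on m: after the
-- least element x of X₀, ω^(n+m+1) has become ω^(n+m)·x, while the later maxima are
-- ω^m·(max X₀)-large, hence ω^m·x-large. Cutting them into x consecutive ω^m-large
-- runs, the induction hypothesis makes the union of each run ω^(n+m)-large.
module Submission where

open import Defs
open import Data.Nat using (ℕ; zero; suc; _<_; _≤_; _+_; _∸_)
open import Data.Nat.Properties using (m≤m⊔n; m+[n∸m]≡n; <⇒≤; +-suc; +-identityʳ)
open import Data.List using (List; []; _∷_; _++_; map; concat; take; drop)
open import Data.List.Properties using (take-map; drop-map; concat-++; take++drop≡id)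
open import Data.List.Relation.Unary.All using (All; _∷_)
import Data.List.Relation.Unary.All.Properties as All
open import Data.List.Relation.Unary.AllPairs using (AllPairs; _∷_)
import Data.List.Relation.Unary.AllPairs as AllPairs
import Data.List.Relation.Unary.AllPairs.Properties as AllPairs
open import Data.Product using (Σ; _×_; _,_)
open import Function using (flip)
open import Relation.Binary.PropositionalEquality using (_≡_; refl; sym; trans; cong; subst)

-- This is ordinal addition only when the result is again in normal form, but fs
-- treats it as a sum in every case (fs-⊕).
infixl 6 _⊕_
_⊕_ : Ord → Ord → Ord
α ⊕ 𝟘        = α
α ⊕ (δ ⊕ω^ γ) = (α ⊕ δ) ⊕ω^ γ

ω^_·_ : Ord → ℕ → Ord
ω^ γ · c = addMul 𝟘 γ c

ω^·-+ : ∀ γ a b → ω^ γ · (a + b) ≡ ω^ γ · b ⊕ ω^ γ · a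
ω^·-+ _ zero    _ = refl
ω^·-+ γ (suc a) b = cong (_⊕ω^ γ) (ω^·-+ γ a b)

addMul-⊕ : ∀ α δ γ x → addMul (α ⊕ δ) γ x ≡ α ⊕ addMul δ γ x
addMul-⊕ _ _ _ zero    = refl
addMul-⊕ α δ γ (suc x) = cong (_⊕ω^ γ) (addMul-⊕ α δ γ x)

fs-⊕ : ∀ α δ γ x → fs (α ⊕ (δ ⊕ω^ γ)) x ≡ α ⊕ fs (δ ⊕ω^ γ) x
fs-⊕ _ _ 𝟘                 _ = refl
fs-⊕ α δ (γ ⊕ω^ 𝟘)         x = addMul-⊕ α δ γ x
fs-⊕ _ _ (_ ⊕ω^ (_ ⊕ω^ _)) _ = refl

Sorted : List ℕ → Set
Sorted = AllPairs _<_

Large-𝟘 : ∀ W → Large 𝟘 W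
Large-𝟘 []      = refl
Large-𝟘 (_ ∷ W) = Large-𝟘 W

Large-++⁺ˡ : ∀ α A B → Large α A → Large α (A ++ B)
Large-++⁺ˡ α []      B refl = Large-𝟘 B
Large-++⁺ˡ α (a ∷ A) B l    = Large-++⁺ˡ (fs α a) A B l

PrependClosed : Ord → Set
PrependClosed α = ∀ {z Y} → Sorted (z ∷ Y) → Large α Y → Large α (z ∷ Y)

Large-++⁺ʳ : ∀ {α} → PrependClosed α → ∀ Z {Y} → Sorted (Z ++ Y) → Large α Y → Large α (Z ++ Y)
Large-++⁺ʳ _  []      _       l = l
Large-++⁺ʳ cl (z ∷ Z) (p ∷ s) l = cl (p ∷ s) (Large-++⁺ʳ cl Z s l)

Large-⊕⁻ : ∀ α β W → Large (α ⊕ β) W → Σ ℕ λ k → Large β (take k W) × Large α (drop k W)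
Large-⊕⁻ _ 𝟘         _       l = 0 , refl , l
Large-⊕⁻ _ (_ ⊕ω^ _) []      ()
Large-⊕⁻ α (δ ⊕ω^ γ) (w ∷ W) l
  with k , lβ , lα ← Large-⊕⁻ α (fs (δ ⊕ω^ γ) w) W (subst (flip Large W) (fs-⊕ α δ γ w) l)
  = suc k , lβ , lα

Large-⊕⁻ʳ : ∀ α β W → Large (α ⊕ β) W → Large β W
Large-⊕⁻ʳ _ 𝟘         W       _ = Large-𝟘 W
Large-⊕⁻ʳ _ (_ ⊕ω^ _) []      ()
Large-⊕⁻ʳ α (δ ⊕ω^ γ) (w ∷ W) l =
  Large-⊕⁻ʳ α (fs (δ ⊕ω^ γ) w) W (subst (flip Large W) (fs-⊕ α δ γ w) l)

Large-⊕⁺ : ∀ {α} → PrependClosed α → ∀ β A B → Sorted (A ++ B) →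
           Large β A → Large α B → Large (α ⊕ β) (A ++ B)
Large-⊕⁺     cl 𝟘         A       _ s       _  lα = Large-++⁺ʳ cl A s lα
Large-⊕⁺     _  (_ ⊕ω^ _) []      _ _       ()
Large-⊕⁺ {α} cl (δ ⊕ω^ γ) (a ∷ A) B (_ ∷ s) lβ lα =
  subst (flip Large (A ++ B)) (sym (fs-⊕ α δ γ a)) (Large-⊕⁺ cl (fs (δ ⊕ω^ γ) a) A B s lβ lα)

Large-ω^·-anti : ∀ γ {a b} W → a ≤ b → Large (ω^ γ · b) W → Large (ω^ γ · a) W
Large-ω^·-anti γ {a} {b} W a≤b l =
  Large-⊕⁻ʳ (ω^ γ · (b ∸ a)) (ω^ γ · a) W
    (subst (flip Large W) (trans (cong (ω^ γ ·_) (sym (m+[n∸m]≡n a≤b))) (ω^·-+ γ a (b ∸ a))) l)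

prependClosed-𝟘 : PrependClosed 𝟘
prependClosed-𝟘 {Y = Y} _ _ = Large-𝟘 Y

prependClosed-⊕ : ∀ {α β} → PrependClosed α → PrependClosed β → PrependClosed (α ⊕ β)
prependClosed-⊕ {β = 𝟘}       clα _   s l = clα s l
prependClosed-⊕ {α} {δ ⊕ω^ γ} clα clβ {z} {Y} s@(_ ∷ sY) l
  with k , lβ , lα ← Large-⊕⁻ α (δ ⊕ω^ γ) Y l =
  subst (flip Large Y) (sym (fs-⊕ α δ γ z))
    (subst (Large (α ⊕ fs (δ ⊕ω^ γ) z)) (take++drop≡id k Y)
      (Large-⊕⁺ clα (fs (δ ⊕ω^ γ) z) (take k Y) (drop k Y)
        (subst Sorted (sym (take++drop≡id k Y)) sY)
        (clβ (AllPairs.take⁺ (suc k) s) lβ) lα))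

mutual
  prependClosed-ω^· : ∀ j c → PrependClosed (ω^ (nat j) · c)
  prependClosed-ω^· j zero    = prependClosed-𝟘
  prependClosed-ω^· j (suc c) = prependClosed-⊕ (prependClosed-ω^· j c) (prependClosed-ω^ j)

  prependClosed-ω^ : ∀ k → PrependClosed (ω^ (nat k))
  prependClosed-ω^ zero    {Y = Y}     _ _ = Large-𝟘 Y
  prependClosed-ω^ (suc j) {Y = []}    _ ()
  prependClosed-ω^ (suc j) {z} {y ∷ Y} ((z<y ∷ _) ∷ s) l =
    prependClosed-ω^· j z s (Large-ω^·-anti (nat j) Y (<⇒≤ z<y) l)

BlockTransfer : ℕ → Ord → Ord → Set
BlockTransfer n α β = ∀ Xs → All Sorted Xs → All (Large (ω^ (nat n))) Xs → AllPairs _≪_ Xs →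
                      Large α (map maxL Xs) → Large β (concat Xs)

concat-take++drop : ∀ k (Xs : List (List ℕ)) → concat (take k Xs) ++ concat (drop k Xs) ≡ concat Xs
concat-take++drop k Xs = trans (concat-++ (take k Xs) (drop k Xs)) (cong concat (take++drop≡id k Xs))

transfer-⊕ : ∀ {n α β α′ β′} → BlockTransfer n α β → BlockTransfer n α′ β′ → PrependClosed β′ →
             BlockTransfer n (α′ ⊕ α) (β′ ⊕ β)
transfer-⊕ {α = α} {α′ = α′} {β′ = β′} t t′ cl Xs sX lX ≪X l
  with k , lα , lα′ ← Large-⊕⁻ α′ α (map maxL Xs) l =
  subst (Large (β′ ⊕ _)) (concat-take++drop k Xs)
    (Large-⊕⁺ cl _ (concat (take k Xs)) (concat (drop k Xs))
      (subst Sorted (sym (concat-take++drop k Xs)) (AllPairs.concat⁺ sX ≪X))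
      (t  (take k Xs) (All.take⁺ k sX) (All.take⁺ k lX) (AllPairs.take⁺ k ≪X)
          (subst (Large α) (take-map k Xs) lα))
      (t′ (drop k Xs) (All.drop⁺ k sX) (All.drop⁺ k lX) (AllPairs.drop⁺ k ≪X)
          (subst (Large α′) (drop-map k Xs) lα′)))

transfer-ω^· : ∀ {n α k} → BlockTransfer n (ω^ α) (ω^ (nat k)) →
               ∀ c → BlockTransfer n (ω^ α · c) (ω^ (nat k) · c)
transfer-ω^· t zero          Xs _ _ _ _ = Large-𝟘 (concat Xs)
transfer-ω^· {k = k} t (suc c) = transfer-⊕ t (transfer-ω^· t c) (prependClosed-ω^· k c)

transfer-ω^ : ∀ n m → BlockTransfer n (ω^ (nat m)) (ω^ (nat (n + m)))
transfer-ω^ n m       []             _ _ _ ()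
transfer-ω^ n zero    (X ∷ Xs)       _ (lX ∷ _) _ _
  rewrite +-identityʳ n = Large-++⁺ˡ (ω^ (nat n)) X (concat Xs) lX
transfer-ω^ n (suc m) ([] ∷ Xs)      _ (() ∷ _)
transfer-ω^ n (suc m) ((x ∷ X) ∷ Xs) sXs@(_ ∷ sXs′) (_ ∷ lXs) ≪Xs@(_ ∷ ≪Xs′) l
  rewrite +-suc n m =
  Large-++⁺ʳ (prependClosed-ω^· (n + m) x) X (AllPairs.tail (AllPairs.concat⁺ sXs ≪Xs))
    (transfer-ω^· (transfer-ω^ n m) x Xs sXs′ lXs ≪Xs′
      (Large-ω^·-anti (nat m) (map maxL Xs) (m≤m⊔n x (maxL X)) l))

mainTheorem7 : (n m : ℕ) (Xs : List (List ℕ)) →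
    All (AllPairs _<_) Xs →
    All (Large (ω^ (nat n))) Xs →
    AllPairs _≪_ Xs →
    Large (ω^ (nat m)) (map maxL Xs) →
    Large (ω^ (nat (n + m))) (concat Xs)
mainTheorem7 = transfer-ω^
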